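{- Let $\mathbb{B}$ be a complete Boolean algebra and $U$ an ultrafilter on $\mathbb{B}$. The following are equivalent: (1) $U$ is $\aleph_0$-regular; (2) $U$ is $\aleph_0$-quasiregular; (3) $U$ is $\aleph_1$-incomplete.
   Context: A maximal antichain of $\mathbb{B}$ is a set of nonzero pairwise disjoint elements with join $\mathbbm{1}$. For an infinite cardinal $\kappa$, a filter $F$ on $\mathbb{B}$ is $\kappa$-regular iff there exist a family $\{x_\alpha : \alpha<\kappa\}\subseteq F$ and a maximal antichain $A\subset\mathbb{B}$ such that: for every $\alpha<\kappa$ and $a\in A$, either $a\le x_\alpha$ or $a\wedge x_\alpha=\mathbbm{0}$; and for every $a\in A$ the set $\{\alpha<\kappa : a\le x_\alpha\}$ is finite. $F$ is $\kappa$-quasiregular iff there is a family $\{x_\alpha : \alpha<\kappa\}\subseteq F$ such that $\bigwedge_{\alpha\in I}x_\alpha=\mathbbm{0}$ for every infinite $I\subseteq\kappa$. A filter $F$ is $\aleph_1$-incomplete iff there exists a countable $X\subseteq F$ with $\bigwedge X\notin F$. -}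

module Defs where

open import Level using (Level; _⊔_; Lift)
open import Data.Nat using (ℕ; _<_; _≤_)
open import Data.Product using (Σ; _×_; ∃; ∃-syntax; _,_)
open import Data.Sum using (_⊎_)
open import Relation.Nullary using (¬_)
open import Relation.Unary using (Pred; _∈_; _∉_)
open import Algebra.Lattice.Bundles using (BooleanAlgebra)

module _ {c ℓ : Level} (B : BooleanAlgebra c ℓ) where
  open BooleanAlgebra B renaming (¬_ to ∁_)

  Subset : Set _
  Subset = Pred Carrier (c ⊔ ℓ)

  _≤ᴮ_ : Carrier → Carrier → Set ℓ
  x ≤ᴮ y = x ∧ y ≈ x

  IsJoin : Subset → Carrier → Set _
  IsJoin S j = (∀ x → x ∈ S → x ≤ᴮ j) × (∀ u → (∀ x → x ∈ S → x ≤ᴮ u) → j ≤ᴮ u)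

  IsMeet : Subset → Carrier → Set _
  IsMeet S m = (∀ x → x ∈ S → m ≤ᴮ x) × (∀ l → (∀ x → x ∈ S → l ≤ᴮ x) → l ≤ᴮ m)

  IsComplete : Set _
  IsComplete = ∀ (S : Subset) → ∃[ j ] IsJoin S j

  Image : (ℕ → Set (c ⊔ ℓ)) → (ℕ → Carrier) → Subset
  Image I x y = ∃[ i ] (I i × y ≈ x i)

  Range : (ℕ → Carrier) → Subset
  Range x y = Lift (c ⊔ ℓ) (∃[ i ] (y ≈ x i))

  InfiniteSubset : (ℕ → Set (c ⊔ ℓ)) → Set _
  InfiniteSubset I = ∀ n → ∃[ m ] (n ≤ m × I m)

  FiniteSubset : ∀ {p} → (ℕ → Set p) → Set p
  FiniteSubset I = ∃[ n ] (∀ m → I m → m < n)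

  IsFilter : Subset → Set _
  IsFilter F = (⊤ ∈ F)
             × (⊥ ∉ F)
             × (∀ x y → x ∈ F → y ∈ F → (x ∧ y) ∈ F)
             × (∀ x y → x ∈ F → x ≤ᴮ y → y ∈ F)

  IsUltrafilter : Subset → Set _
  IsUltrafilter U = IsFilter U × (∀ x → x ∈ U ⊎ (∁ x) ∈ U)

  IsMaximalAntichain : Subset → Set _
  IsMaximalAntichain A =
      (∀ a → a ∈ A → ¬ (a ≈ ⊥))
    × (∀ a b → a ∈ A → b ∈ A → ¬ (a ≈ b) → a ∧ b ≈ ⊥)
    × IsJoin A ⊤

  Aleph0Regular : Subset → Set _
  Aleph0Regular F =
    Σ (ℕ → Carrier) λ x → Σ Subset λ A →
        (∀ α → x α ∈ F)
      × IsMaximalAntichain A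
      × (∀ α a → a ∈ A → (a ≤ᴮ x α) ⊎ (a ∧ x α ≈ ⊥))
      × (∀ a → a ∈ A → FiniteSubset (λ α → a ≤ᴮ x α))

  Aleph0Quasiregular : Subset → Set _
  Aleph0Quasiregular F =
    Σ (ℕ → Carrier) λ x →
        (∀ α → x α ∈ F)
      × (∀ (I : ℕ → Set (c ⊔ ℓ)) → InfiniteSubset I → IsMeet (Image I x) ⊥)

  -- ℵ₁-incomplete: some countable X ⊆ F (the range of a sequence) has meet ∉ F
  Aleph1Incomplete : Subset → Set _
  Aleph1Incomplete F =
    Σ (ℕ → Carrier) λ x →
        (∀ n → x n ∈ F)
      × ∃[ m ] (IsMeet (Range x) m × m ∉ F)

module Submission where

-- The proof is organised around one intermediate notion: a sequence z in a
-- filter F that DESCENDS TO ZERO, i.e. z₀ ≥ z₁ ≥ … and ⊥ is the only common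
-- lower bound of the zₙ.
--   * regular ⇒ quasiregular: a lower bound of infinitely many members of the
--     regular family is disjoint from every element of the antichain, hence ⊥.
--   * quasiregular ⇒ incomplete: the witnessing family has meet ⊥ ∉ F.
--   * quasiregular ⇒ descends to zero, and incomplete ⇒ descends to zero: take
--     partial meets x₀ ∧ … ∧ xₙ (for incompleteness, of xₙ ∧ ¬m, m the meet).
--   * descends to zero ⇒ quasiregular: any infinite subfamily is cofinal.
--   * descends to zero ⇒ regular: the nonzero "pieces" zₙ ∧ ¬zₙ₊₁ (with ⊤ put
--     in front of z) form a maximal antichain; its join is ⊤ because z
--     descends to zero.  Deciding which pieces are zero uses excluded middle.

open import Defs
open import Level using (Level; _⊔_; Lift; lift; lower)
open import Data.Product using (_×_; _,_; proj₂; ∃-syntax)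
open import Data.Sum using (_⊎_; inj₁; inj₂)
open import Data.Unit using (tt) renaming (⊤ to Unit)
open import Data.Nat using (ℕ; zero; suc; z≤n; s≤s) renaming (_≤_ to _≤ℕ_; _<_ to _<ℕ_)
open import Data.Nat.Properties using (_≤?_; ≤-refl; ≰⇒>; <-cmp; <⇒≱; m≤n⇒m<n∨m≡n)
open import Data.Empty using (⊥-elim)
open import Relation.Nullary using (yes; no) renaming (¬_ to Not)
open import Relation.Unary using (_∈_)
open import Relation.Binary using (tri<; tri≈; tri>)
open import Relation.Binary.PropositionalEquality using () renaming (refl to ≡-refl)
open import Function.Bundles using (_⇔_; mk⇔)
open import Axiom.ExcludedMiddle using (ExcludedMiddle)
open import Algebra.Lattice.Bundles using (BooleanAlgebra)
import Algebra.Lattice.Properties.BooleanAlgebra as BooleanAlgebraProperties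
import Relation.Binary.Reasoning.Setoid as SetoidReasoning

module _ {c ℓ : Level} (B : BooleanAlgebra c ℓ) where
  open BooleanAlgebra B renaming (¬_ to ∁_)
  open BooleanAlgebraProperties B
    using (∧-idem; ∧-identityʳ; ∧-identityˡ; ∧-zeroʳ; ∧-zeroˡ; ∨-identityʳ; ¬-involutive; ¬⊥≈⊤)
  open SetoidReasoning setoid

  infix 4 _⊑_
  _⊑_ : Carrier → Carrier → Set ℓ
  _⊑_ = _≤ᴮ_ B

  ⊑-refl : ∀ x → x ⊑ x
  ⊑-refl = ∧-idem

  ⊑-resp : ∀ {x x′ y y′} → x ≈ x′ → y ≈ y′ → x ⊑ y → x′ ⊑ y′
  ⊑-resp {x} {x′} {y} {y′} x≈x′ y≈y′ x⊑y = begin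
    x′ ∧ y′ ≈⟨ ∧-cong (sym x≈x′) (sym y≈y′) ⟩
    x ∧ y   ≈⟨ x⊑y ⟩
    x       ≈⟨ x≈x′ ⟩
    x′      ∎

  ⊑-trans : ∀ {x y z} → x ⊑ y → y ⊑ z → x ⊑ z
  ⊑-trans {x} {y} {z} x⊑y y⊑z = begin
    x ∧ z       ≈⟨ ∧-congʳ (sym x⊑y) ⟩
    (x ∧ y) ∧ z ≈⟨ ∧-assoc x y z ⟩
    x ∧ (y ∧ z) ≈⟨ ∧-congˡ y⊑z ⟩
    x ∧ y       ≈⟨ x⊑y ⟩
    x           ∎

  x∧y⊑x : ∀ x y → x ∧ y ⊑ x
  x∧y⊑x x y = begin
    (x ∧ y) ∧ x ≈⟨ ∧-congʳ (∧-comm x y) ⟩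
    (y ∧ x) ∧ x ≈⟨ ∧-assoc y x x ⟩
    y ∧ (x ∧ x) ≈⟨ ∧-congˡ (∧-idem x) ⟩
    y ∧ x       ≈⟨ ∧-comm y x ⟩
    x ∧ y       ∎

  x∧y⊑y : ∀ x y → x ∧ y ⊑ y
  x∧y⊑y x y = begin
    (x ∧ y) ∧ y ≈⟨ ∧-assoc x y y ⟩
    x ∧ (y ∧ y) ≈⟨ ∧-congˡ (∧-idem y) ⟩
    x ∧ y       ∎

  ∧-greatest : ∀ {l x y} → l ⊑ x → l ⊑ y → l ⊑ x ∧ y
  ∧-greatest {l} {x} {y} l⊑x l⊑y = begin
    l ∧ (x ∧ y) ≈⟨ sym (∧-assoc l x y) ⟩
    (l ∧ x) ∧ y ≈⟨ ∧-congʳ l⊑x ⟩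
    l ∧ y       ≈⟨ l⊑y ⟩
    l           ∎

  ⊥⊑ : ∀ x → ⊥ ⊑ x
  ⊥⊑ = ∧-zeroˡ

  ⊑⊤ : ∀ x → x ⊑ ⊤
  ⊑⊤ = ∧-identityʳ

  ⊑⊥⇒≈⊥ : ∀ {x} → x ⊑ ⊥ → x ≈ ⊥
  ⊑⊥⇒≈⊥ {x} x⊑⊥ = trans (sym x⊑⊥) (∧-zeroʳ x)

  ≈⊥⇒⊑⊥ : ∀ {x} → x ≈ ⊥ → x ⊑ ⊥
  ≈⊥⇒⊑⊥ {x} x≈⊥ = trans (∧-zeroʳ x) (sym x≈⊥)

  below-both⇒⊥ : ∀ {x y} → x ⊑ y → x ⊑ ∁ y → x ≈ ⊥
  below-both⇒⊥ {y = y} x⊑y x⊑∁y =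
    ⊑⊥⇒≈⊥ (⊑-resp refl (∧-complementʳ y) (∧-greatest x⊑y x⊑∁y))

  disjoint-∁⇒⊑ : ∀ {x y} → x ∧ ∁ y ≈ ⊥ → x ⊑ y
  disjoint-∁⇒⊑ {x} {y} x∧∁y≈⊥ = begin
    x ∧ y               ≈⟨ sym (∨-identityʳ (x ∧ y)) ⟩
    (x ∧ y) ∨ ⊥         ≈⟨ ∨-congˡ (sym x∧∁y≈⊥) ⟩
    (x ∧ y) ∨ (x ∧ ∁ y) ≈⟨ sym (∧-distribˡ-∨ x y (∁ y)) ⟩
    x ∧ (y ∨ ∁ y)       ≈⟨ ∧-congˡ (∨-complementʳ y) ⟩
    x ∧ ⊤               ≈⟨ ∧-identityʳ x ⟩
    x                   ∎

  disjoint-mono : ∀ {a b d} → a ⊑ b → b ∧ d ≈ ⊥ → a ∧ d ≈ ⊥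
  disjoint-mono {a} {b} {d} a⊑b b∧d≈⊥ = begin
    a ∧ d       ≈⟨ ∧-congʳ (sym a⊑b) ⟩
    (a ∧ b) ∧ d ≈⟨ ∧-assoc a b d ⟩
    a ∧ (b ∧ d) ≈⟨ ∧-congˡ b∧d≈⊥ ⟩
    a ∧ ⊥       ≈⟨ ∧-zeroʳ a ⟩
    ⊥           ∎

  disjoint⇒⊑∁ : ∀ {a b} → a ∧ b ≈ ⊥ → a ⊑ ∁ b
  disjoint⇒⊑∁ {b = b} a∧b≈⊥ = disjoint-∁⇒⊑ (trans (∧-congˡ (¬-involutive b)) a∧b≈⊥)

  ⊑∁⇒disjoint : ∀ {a b} → a ⊑ ∁ b → a ∧ b ≈ ⊥
  ⊑∁⇒disjoint {b = b} a⊑∁b = disjoint-mono a⊑∁b (trans (∧-comm (∁ b) b) (∧-complementʳ b))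

  ⊤⊑∁⇒≈⊥ : ∀ {x} → ⊤ ⊑ ∁ x → x ≈ ⊥
  ⊤⊑∁⇒≈⊥ {x} ⊤⊑∁x = below-both⇒⊥ (⊑-refl x) (⊑-trans (⊑⊤ x) ⊤⊑∁x)

  ∁≈⊥⇒⊤⊑ : ∀ {x} → ∁ x ≈ ⊥ → ⊤ ⊑ x
  ∁≈⊥⇒⊤⊑ {x} ∁x≈⊥ = begin
    ⊤ ∧ x ≈⟨ ∧-identityˡ x ⟩
    x     ≈⟨ sym (¬-involutive x) ⟩
    ∁ ∁ x ≈⟨ ¬-cong ∁x≈⊥ ⟩
    ∁ ⊥   ≈⟨ ¬⊥≈⊤ ⟩
    ⊤     ∎

  Descending : (ℕ → Carrier) → Set ℓ
  Descending z = ∀ n → z (suc n) ⊑ z n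

  MeetIsZero : (ℕ → Carrier) → Set (c ⊔ ℓ)
  MeetIsZero z = ∀ l → (∀ n → l ⊑ z n) → l ≈ ⊥

  descending-antitone : ∀ {z} → Descending z → ∀ {k n} → k ≤ℕ n → z n ⊑ z k
  descending-antitone {z} desc {n = zero}  z≤n = ⊑-refl (z zero)
  descending-antitone {z} desc {n = suc n} k≤1+n with m≤n⇒m<n∨m≡n k≤1+n
  ... | inj₁ (s≤s k≤n) = ⊑-trans (desc n) (descending-antitone desc k≤n)
  ... | inj₂ ≡-refl    = ⊑-refl (z (suc n))

  partialMeet : (ℕ → Carrier) → ℕ → Carrier
  partialMeet x zero    = x zero
  partialMeet x (suc n) = partialMeet x n ∧ x (suc n)

  partialMeet-descending : ∀ x → Descending (partialMeet x)
  partialMeet-descending x n = x∧y⊑x (partialMeet x n) (x (suc n))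

  partialMeet-⊑ : ∀ x n → partialMeet x n ⊑ x n
  partialMeet-⊑ x zero    = ⊑-refl (x zero)
  partialMeet-⊑ x (suc n) = x∧y⊑y (partialMeet x n) (x (suc n))

  record DescendsToZero (F : Subset B) (z : ℕ → Carrier) : Set (c ⊔ ℓ) where
    field
      inF        : ∀ n → z n ∈ F
      descending : Descending z
      meetIsZero : MeetIsZero z

  partialMeets-descendToZero : (F : Subset B) → (∀ x y → x ∈ F → y ∈ F → x ∧ y ∈ F) →
    ∀ x → (∀ n → x n ∈ F) → MeetIsZero x → DescendsToZero F (partialMeet x)
  partialMeets-descendToZero F ∧-closed x x∈F meet⊥ = record
    { inF        = inF
    ; descending = partialMeet-descending x
    ; meetIsZero = λ l l⊑ → meet⊥ l (λ n → ⊑-trans (l⊑ n) (partialMeet-⊑ x n))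
    }
    where
      inF : ∀ n → partialMeet x n ∈ F
      inF zero    = x∈F zero
      inF (suc n) = ∧-closed _ _ (inF n) (x∈F (suc n))

  allℕ : ℕ → Set (c ⊔ ℓ)
  allℕ _ = Lift (c ⊔ ℓ) Unit

  allℕ-infinite : InfiniteSubset B allℕ
  allℕ-infinite n = n , ≤-refl , lift tt

  quasiregular⇒meetIsZero : ∀ x → (∀ I → InfiniteSubset B I → IsMeet B (Image B I x) ⊥) →
    MeetIsZero x
  quasiregular⇒meetIsZero x quasi l l⊑ =
    ⊑⊥⇒≈⊥ (proj₂ (quasi allℕ allℕ-infinite) l (λ y (i , _ , y≈xi) → ⊑-resp refl (sym y≈xi) (l⊑ i)))

  ⊥-isMeet : ∀ S → (∀ l → (∀ y → y ∈ S → l ⊑ y) → l ≈ ⊥) → IsMeet B S ⊥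
  ⊥-isMeet S lower⇒⊥ = (λ y _ → ⊥⊑ y) , (λ l l⊑S → ≈⊥⇒⊑⊥ (lower⇒⊥ l l⊑S))

  -- regular ⇒ quasiregular (for any F): a lower bound l of an infinite
  -- subfamily is disjoint from each antichain element a, since a is disjoint
  -- from x_α for all large α; so ∁ l bounds the antichain, whose join is ⊤.
  regular⇒quasiregular : ∀ F → Aleph0Regular B F → Aleph0Quasiregular B F
  regular⇒quasiregular F (x , A , x∈F , (_ , _ , (_ , join-least)) , below-or-disjoint , finite) =
    x , x∈F , λ I I-inf → ⊥-isMeet _ λ l l⊑ →
      ⊤⊑∁⇒≈⊥ (join-least (∁ l) (λ a a∈A → disjoint⇒⊑∁ (disjoint-from-lowerBound I I-inf l l⊑ a a∈A)))
    where
      disjoint-from-lowerBound : ∀ I → InfiniteSubset B I → ∀ l → (∀ y → y ∈ Image B I x → l ⊑ y) →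
        ∀ a → a ∈ A → a ∧ l ≈ ⊥
      disjoint-from-lowerBound I I-inf l l⊑ a a∈A with finite a a∈A
      ... | n , bound with I-inf n
      ... | α , n≤α , α∈I with below-or-disjoint α a a∈A
      ... | inj₁ a⊑xα  = ⊥-elim (<⇒≱ (bound α a⊑xα) n≤α)
      ... | inj₂ a∧xα≈⊥ =
        trans (∧-comm a l) (disjoint-mono (l⊑ (x α) (α , α∈I , refl)) (trans (∧-comm (x α) a) a∧xα≈⊥))

  quasiregular⇒incomplete : ∀ F → IsFilter B F → Aleph0Quasiregular B F → Aleph1Incomplete B F
  quasiregular⇒incomplete F (_ , ⊥∉F , _) (x , x∈F , quasi) =
    x , x∈F , ⊥ , ⊥-isMeet _ (λ l l⊑ → meet⊥ l (λ n → l⊑ (x n) (lift (n , refl)))) , ⊥∉F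
    where
      meet⊥ : MeetIsZero x
      meet⊥ = quasiregular⇒meetIsZero x quasi

  quasiregular⇒descendsToZero : ∀ F → IsFilter B F → Aleph0Quasiregular B F →
    ∃[ z ] DescendsToZero F z
  quasiregular⇒descendsToZero F (_ , _ , ∧-closed , _) (x , x∈F , quasi) =
    partialMeet x , partialMeets-descendToZero F ∧-closed x x∈F (quasiregular⇒meetIsZero x quasi)

  -- ℵ₁-incomplete ⇒ descends to zero (for an ultrafilter): if m = ⋀ xₙ ∉ U then
  -- ∁ m ∈ U, and a common lower bound of the xₙ ∧ ∁ m lies below both m and ∁ m.
  incomplete⇒descendsToZero : ∀ U → IsUltrafilter B U → Aleph1Incomplete B U →
    ∃[ z ] DescendsToZero U z
  incomplete⇒descendsToZero U ((_ , _ , ∧-closed , _) , ultra) (x , x∈U , m , (_ , m-greatest) , m∉U) =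
    partialMeet y , partialMeets-descendToZero U ∧-closed y y∈U meet⊥
    where
      ∁m∈U : ∁ m ∈ U
      ∁m∈U with ultra m
      ... | inj₁ m∈U  = ⊥-elim (m∉U m∈U)
      ... | inj₂ ∁m∈U = ∁m∈U

      y : ℕ → Carrier
      y n = x n ∧ ∁ m

      y∈U : ∀ n → y n ∈ U
      y∈U n = ∧-closed _ _ (x∈U n) ∁m∈U

      meet⊥ : MeetIsZero y
      meet⊥ l l⊑y = below-both⇒⊥ l⊑m (⊑-trans (l⊑y 0) (x∧y⊑y (x 0) (∁ m)))
        where
          l⊑m : l ⊑ m
          l⊑m = m-greatest l λ v v∈range → let (n , v≈xn) = lower v∈range in
            ⊑-resp refl (sym v≈xn) (⊑-trans (l⊑y n) (x∧y⊑x (x n) (∁ m)))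

  -- descends to zero ⇒ quasiregular (for any F): an infinite index set I is
  -- cofinal, so a lower bound of {z_i : i ∈ I} is below every zₙ.
  descendsToZero⇒quasiregular : ∀ F z → DescendsToZero F z → Aleph0Quasiregular B F
  descendsToZero⇒quasiregular F z record { inF = z∈F ; descending = desc ; meetIsZero = meet⊥ } =
    z , z∈F , λ I I-inf → ⊥-isMeet _ λ l l⊑ → meet⊥ l λ n →
      let (k , n≤k , k∈I) = I-inf n in
      ⊑-trans (l⊑ (z k) (k , k∈I , refl)) (descending-antitone desc n≤k)

  -- With y = ⊤, z₀, z₁, …, the pieces pₙ = yₙ ∧ ∁ yₙ₊₁ are pairwise disjoint,
  -- pₙ ⊑ y_α for α ≤ n and pₙ ∧ y_α ≈ ⊥ for α > n; the nonzero pieces form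
  -- the antichain witnessing regularity of the family y.
  module DescendingPieces (F : Subset B) (z : ℕ → Carrier) (z↓0 : DescendsToZero F z) where
    open DescendsToZero z↓0

    y : ℕ → Carrier
    y zero    = ⊤
    y (suc n) = z n

    y-descending : Descending y
    y-descending zero    = ⊑⊤ (z 0)
    y-descending (suc n) = descending n

    piece : ℕ → Carrier
    piece n = y n ∧ ∁ y (suc n)

    Pieces : Subset B
    Pieces v = Lift (c ⊔ ℓ) (∃[ n ] (v ≈ piece n × Not (v ≈ ⊥)))

    piece-below : ∀ {α n} → α ≤ℕ n → piece n ⊑ y α
    piece-below α≤n = ⊑-trans (x∧y⊑x _ _) (descending-antitone y-descending α≤n)

    piece-disjoint-later : ∀ {n α} → n <ℕ α → piece n ∧ y α ≈ ⊥
    piece-disjoint-later {n} n<α =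
      trans (∧-comm _ _) (disjoint-mono (descending-antitone y-descending n<α)
        (trans (∧-comm _ _) (⊑∁⇒disjoint (x∧y⊑y (y n) (∁ y (suc n))))))

    pieces-disjoint : ∀ {n k} → n <ℕ k → piece n ∧ piece k ≈ ⊥
    pieces-disjoint n<k =
      trans (∧-comm _ _) (disjoint-mono (x∧y⊑x _ _) (trans (∧-comm _ _) (piece-disjoint-later n<k)))

    Pieces-pairwiseDisjoint : ∀ v u → v ∈ Pieces → u ∈ Pieces → Not (v ≈ u) → v ∧ u ≈ ⊥
    Pieces-pairwiseDisjoint v u (lift (n , v≈ , _)) (lift (k , u≈ , _)) v≉u with <-cmp n k
    ... | tri< n<k _ _     = trans (∧-cong v≈ u≈) (pieces-disjoint n<k)
    ... | tri≈ _ ≡-refl _ = ⊥-elim (v≉u (trans v≈ (sym u≈)))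
    ... | tri> _ _ k<n     = trans (∧-cong v≈ u≈) (trans (∧-comm _ _) (pieces-disjoint k<n))

    -- If u bounds the nonzero pieces then ∁ u lies below every yₙ (induction on
    -- n: ∁ u ∧ ∁ yₙ₊₁ ≈ ∁ u ∧ pₙ ≈ ⊥), hence ∁ u ≈ ⊥ and u is ⊤.
    Pieces-join⊤ : ExcludedMiddle ℓ → ∀ u → (∀ v → v ∈ Pieces → v ⊑ u) → ⊤ ⊑ u
    Pieces-join⊤ lem u u-bound = ∁≈⊥⇒⊤⊑ (meetIsZero (∁ u) (λ n → ∁u⊑y (suc n)))
      where
        ∁u-disjoint : ∀ n → ∁ u ∧ piece n ≈ ⊥
        ∁u-disjoint n with lem {P = piece n ≈ ⊥}
        ... | yes pₙ≈⊥ = trans (∧-congˡ pₙ≈⊥) (∧-zeroʳ (∁ u))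
        ... | no  pₙ≉⊥ = trans (∧-comm _ _)
          (⊑∁⇒disjoint (⊑-resp refl (sym (¬-involutive u)) (u-bound (piece n) (lift (n , refl , pₙ≉⊥)))))

        ∁u⊑y : ∀ n → ∁ u ⊑ y n
        ∁u⊑y zero    = ⊑⊤ (∁ u)
        ∁u⊑y (suc n) = disjoint-∁⇒⊑ (begin
          ∁ u ∧ ∁ y (suc n)         ≈⟨ ∧-congʳ (sym (∁u⊑y n)) ⟩
          (∁ u ∧ y n) ∧ ∁ y (suc n) ≈⟨ ∧-assoc _ _ _ ⟩
          ∁ u ∧ piece n             ≈⟨ ∁u-disjoint n ⟩
          ⊥                         ∎)

    Pieces-maximalAntichain : ExcludedMiddle ℓ → IsMaximalAntichain B Pieces
    Pieces-maximalAntichain lem =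
      (λ v v∈P → proj₂ (proj₂ (lower v∈P))) ,
      Pieces-pairwiseDisjoint ,
      (λ v _ → ⊑⊤ v) , Pieces-join⊤ lem

    piece-below-or-disjoint : ∀ α v → v ∈ Pieces → v ⊑ y α ⊎ v ∧ y α ≈ ⊥
    piece-below-or-disjoint α v (lift (n , v≈ , _)) with α ≤? n
    ... | yes α≤n = inj₁ (⊑-resp (sym v≈) refl (piece-below α≤n))
    ... | no  α≰n = inj₂ (trans (∧-congʳ v≈) (piece-disjoint-later (≰⇒> α≰n)))

    piece-finitelyOften : ∀ v → v ∈ Pieces → FiniteSubset B (λ α → v ⊑ y α)
    piece-finitelyOften v (lift (n , v≈ , v≉⊥)) = suc n , bound
      where
        bound : ∀ α → v ⊑ y α → α <ℕ suc n
        bound α v⊑yα with α ≤? n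
        ... | yes α≤n = s≤s α≤n
        ... | no  α≰n = ⊥-elim (v≉⊥ (begin
          v              ≈⟨ v≈ ⟩
          piece n        ≈⟨ sym (⊑-resp v≈ refl v⊑yα) ⟩
          piece n ∧ y α  ≈⟨ piece-disjoint-later (≰⇒> α≰n) ⟩
          ⊥              ∎))

  descendsToZero⇒regular : ExcludedMiddle ℓ → ∀ F → IsFilter B F → ∀ z → DescendsToZero F z →
    Aleph0Regular B F
  descendsToZero⇒regular lem F (⊤∈F , _) z z↓0 =
    y , Pieces , y∈F , Pieces-maximalAntichain lem , piece-below-or-disjoint , piece-finitelyOften
    where
      open DescendingPieces F z z↓0
      y∈F : ∀ n → y n ∈ F
      y∈F zero    = ⊤∈F
      y∈F (suc n) = DescendsToZero.inF z↓0 n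

mainTheorem4 : (lem : ∀ {p} → ExcludedMiddle p) →
    ∀ {c ℓ : Level} (B : BooleanAlgebra c ℓ) → IsComplete B →
    (U : Subset B) → IsUltrafilter B U →
    ((Aleph0Regular B U ⇔ Aleph0Quasiregular B U) × (Aleph0Quasiregular B U ⇔ Aleph1Incomplete B U))
mainTheorem4 lem B _ U U-ultra@(U-filter , _) =
  mk⇔ (regular⇒quasiregular B U) quasiregular⇒regular ,
  mk⇔ (quasiregular⇒incomplete B U U-filter) incomplete⇒quasiregular
  where
    quasiregular⇒regular : Aleph0Quasiregular B U → Aleph0Regular B U
    quasiregular⇒regular quasi =
      let (z , z↓0) = quasiregular⇒descendsToZero B U U-filter quasi in
      descendsToZero⇒regular B lem U U-filter z z↓0

    incomplete⇒quasiregular : Aleph1Incomplete B U → Aleph0Quasiregular B U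
    incomplete⇒quasiregular incomplete =
      let (z , z↓0) = incomplete⇒descendsToZero B U U-ultra incomplete in
      descendsToZero⇒quasiregular B U z z↓0
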